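{- For each integer $i\ge-1$, $\#\mathcal{N}_i(2i+3)>0$.
   Context: Young diagrams use English notation (rows indexed top to bottom from 1, columns left to right from 1, $(x,y)$ the box in row $x$, column $y$, row lengths $\lambda_1\ge\lambda_2\ge\cdots$, with $\lambda_j=0$ beyond the last row and $\lambda_0=+\infty$). $\delta_m=(m,m-1,\dots,1)$ for $m\ge1$, $\delta_m=\emptyset$ for $m\le0$; $[m]=\{1,\dots,m\}$. For $d\ge1$, $h_Y(d)=\min\{h\ge1:\lambda_{d-h}\ge\lambda_d+h\}$ is the height of the prime path of row $d$ of $Y$. If $B$ is the last box of row $x_B$, the $B$-strip is the set of last boxes of rows $x_B-h_Y(x_B)+1,\dots,x_B$; $B$ is a corner box if it is also the lowest box of its column. $Y'\gtrdot Y$ if $Y'$ is obtained from $Y$ by deleting the $B$-strip of a corner box $B$ of $Y$. The Tamari lattice $\mathcal T_n$ consists of Young diagrams contained in $\delta_{n-1}$ with the order generated by $\gtrdot$. A tableau fills a Young diagram with positive integers, strictly increasing along rows, weakly increasing down columns, with label set exactly $[l]$, $l=l(T)$; $T(x,y)$ is a label; the $r$-set is the set of boxes labelled $r$; $T^{(r)}$ consists of boxes with labels $\le r$; end-box of a set of boxes = its box in the row of largest index. A $\psi$-tableau is a tableau with $sh(T^{(r-1)})\gtrdot sh(T^{(r)})$ for all $r\in[l(T)]$ (these encode saturated chains; those of shape $\delta_{n-1}$ are the maximal chains of $\mathcal T_n$). For a $\psi$-tableau $C$ of shape $\delta_{n-1}$, the outer diagonal is $\{(k,n-k):k\in[n-1]\}$;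 the $r$-set is a full-set if it contains a box of row 1 and its end-box is an outer-diagonal box $(k,n-k)$, and a plus-full-set if moreover $k=n-1$, or $k\le n-2$ and $C(k+1,n-k-1)<r$. $\mathcal C_i(n)$ is the set of $\psi$-tableaux of shape $\delta_{n-1}$ and length $n+i$, and $\mathcal N_i(n)$ the set of those with no plus-full-set. -}

module Defs where

open import Data.Nat using (ℕ; zero; suc; _+_; _*_; _∸_; _≤_; _<_; _≤?_)
open import Data.List using (List; length; filter; map; upTo)
open import Data.Product using (Σ; ∃; _×_; _,_)
open import Data.Sum using (_⊎_)
open import Relation.Nullary using (¬_)
open import Relation.Binary.PropositionalEquality using (_≡_)

-- Young diagrams (English notation) are given by their row lengths
-- Y : ℕ → ℕ, where Y x (x ≥ 1) is the length of row x.  The value Y 0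
-- is never used; the convention λ₀ = +∞ is built into `HCond`.

YD : Set
YD = ℕ → ℕ

-- condition "λ_{d-h} ≥ λ_d + h" (with λ₀ = +∞, i.e. automatically true
-- when h = d)
HCond : YD → ℕ → ℕ → Set
HCond Y d h = (h ≡ d) ⊎ ((h < d) × (Y d + h ≤ Y (d ∸ h)))

PrimeHeight : YD → ℕ → ℕ → Set
PrimeHeight Y d h =
  (1 ≤ h) × (h ≤ d) × HCond Y d h ×
  (∀ h' → 1 ≤ h' → h' < h → ¬ HCond Y d h')

InStrip : ℕ → ℕ → ℕ → Set
InStrip x h z = (x ∸ h < z) × (z ≤ x)

Covers : YD → YD → Set
Covers Y' Y = Σ ℕ λ x → Σ ℕ λ h →
  (1 ≤ x) × (1 ≤ Y x) × (Y (suc x) < Y x) × PrimeHeight Y x h ×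
  (∀ z → 1 ≤ z →
     (InStrip x h z → Y' z ≡ Y z ∸ 1) ×
     (¬ InStrip x h z → Y' z ≡ Y z))

-- Fillings of the staircase δ_{n-1}: boxes (x , y) with x , y ≥ 1 and
-- x + y ≤ n.  A filling is a function T : ℕ → ℕ → ℕ, only its values
-- on boxes of the shape matter.

InShape : ℕ → ℕ → ℕ → Set
InShape n x y = (1 ≤ x) × (1 ≤ y) × (x + y ≤ n)

Filling : Set
Filling = ℕ → ℕ → ℕ

shapeLe : ℕ → Filling → ℕ → YD
shapeLe n T r x = length (filter (λ y → T x y ≤? r) (map suc (upTo (n ∸ x))))

IsTableau : ℕ → ℕ → Filling → Set
IsTableau n l T =
  (∀ x y → InShape n x y → (1 ≤ T x y) × (T x y ≤ l)) ×
  (∀ r → 1 ≤ r → r ≤ l → Σ ℕ λ x → Σ ℕ λ y → InShape n x y × (T x y ≡ r)) ×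
  (∀ x y → InShape n x y → InShape n x (suc y) → T x y < T x (suc y)) ×
  (∀ x y → InShape n x y → InShape n (suc x) y → T x y ≤ T (suc x) y)

IsPsiTableau : ℕ → ℕ → Filling → Set
IsPsiTableau n l T =
  IsTableau n l T ×
  (∀ r → 1 ≤ r → r ≤ l → Covers (shapeLe n T (r ∸ 1)) (shapeLe n T r))

IsEndBox : ℕ → Filling → ℕ → ℕ → ℕ → Set
IsEndBox n T r k y =
  InShape n k y × (T k y ≡ r) ×
  (∀ x' y' → InShape n x' y' → T x' y' ≡ r → x' ≤ k)

FullSetAt : ℕ → Filling → ℕ → ℕ → Set
FullSetAt n T r k =
  (Σ ℕ λ y → InShape n 1 y × (T 1 y ≡ r)) ×
  (1 ≤ k) × (k ≤ n ∸ 1) × IsEndBox n T r k (n ∸ k)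

PlusFullSet : ℕ → Filling → ℕ → Set
PlusFullSet n T r = Σ ℕ λ k → FullSetAt n T r k ×
  ((k ≡ n ∸ 1) ⊎ ((k ≤ n ∸ 2) × (T (suc k) (n ∸ k ∸ 1) < r)))

-- membership in 𝒩 : ψ-tableau of shape δ_{n-1}, length l, without
-- plus-full-set.  (𝒩_i(n) corresponds to l = n + i.)
InN : ℕ → ℕ → Filling → Set
InN n l T = IsPsiTableau n l T × (∀ r → 1 ≤ r → r ≤ l → ¬ PlusFullSet n T r)

-- Label box (x , y) of δ_{2j} by 3a+1 or 3a+2 when y = 2a+1 or 2a+2, except that
-- the last box of the row of odd length 2a+1 gets 3a+3.  Peeling off the labels from
-- 3j down, the set labelled 3a+3 is that single last box, and the sets labelled
-- 3a+2 and 3a+1 are the boxes of columns 2a+2 and 2a+1 in the rows longer than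
-- 2a+1: a strip whose prime path runs up to row 0.  So every step is a Tamari
-- cover.  A full-set must end in a row of even length 2q+2, since an inner label
-- is never a multiple of 3; its label 3q+2 is then smaller than the label 3q+3 of
-- the last box of the next row, so it is never a plus-full-set.
module Submission where

open import Defs
open import Data.Nat
  using (ℕ; zero; suc; _+_; _*_; _∸_; _≤_; _<_; _≤′_; ≤′-refl; ≤′-step; _≤?_; _≟_; _⊓_; _≡ᵇ_; z≤n; s≤s; pred)
open import Data.Nat.Properties
open import Data.Bool using (true; false; if_then_else_)
open import Data.List using ([]; _∷_; length; filter; map; upTo; _++_)
open import Data.List.Properties using (upTo-∷ʳ; filter-++; length-++; filter-accept; filter-reject; map-++)
open import Data.Product using (Σ; _×_; _,_)
open import Data.Sum using (_⊎_; inj₁; inj₂)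
open import Data.Empty using (⊥)
open import Function.Base using (_∘_)
open import Function.Bundles using (_⇔_; mk⇔; Equivalence)
open import Relation.Nullary using (¬_; Dec; yes; no; contradiction)
open import Relation.Unary using (Pred; Decidable)
open import Relation.Binary.Definitions using (tri<; tri≈; tri>)
open import Relation.Binary.PropositionalEquality

open Equivalence using (to; from)

length-filter-threshold : ∀ {p} {P : Pred ℕ p} (P? : Decidable P) K m →
  (∀ y → 1 ≤ y → y ≤ m → P y ⇔ y ≤ K) →
  length (filter P? (map suc (upTo m))) ≡ m ⊓ K
length-filter-threshold P? K zero _ = refl
length-filter-threshold {P = P} P? K (suc m) P⇔ = begin
    length (filter P? (map suc (upTo (suc m))))
  ≡⟨ cong (λ l → length (filter P? (map suc l))) (sym (upTo-∷ʳ m)) ⟩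
    length (filter P? (map suc (upTo m ++ m ∷ [])))
  ≡⟨ cong (λ l → length (filter P? l)) (map-++ suc (upTo m) (m ∷ [])) ⟩
    length (filter P? (map suc (upTo m) ++ suc m ∷ []))
  ≡⟨ cong length (filter-++ P? (map suc (upTo m)) (suc m ∷ [])) ⟩
    length (filter P? (map suc (upTo m)) ++ filter P? (suc m ∷ []))
  ≡⟨ length-++ (filter P? (map suc (upTo m))) ⟩
    length (filter P? (map suc (upTo m))) + length (filter P? (suc m ∷ []))
  ≡⟨ cong (_+ _) (length-filter-threshold P? K m (λ y 1≤y y≤m → P⇔ y 1≤y (m≤n⇒m≤1+n y≤m))) ⟩
    m ⊓ K + length (filter P? (suc m ∷ []))
  ≡⟨ lastStep (P? (suc m)) ⟩
    suc m ⊓ K ∎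
  where
  open ≡-Reasoning
  last⇔ : P (suc m) ⇔ suc m ≤ K
  last⇔ = P⇔ (suc m) (s≤s z≤n) ≤-refl
  lastStep : Dec (P (suc m)) → m ⊓ K + length (filter P? (suc m ∷ [])) ≡ suc m ⊓ K
  lastStep (yes p) = begin
      m ⊓ K + length (filter P? (suc m ∷ []))
    ≡⟨ cong (λ l → m ⊓ K + length l) (filter-accept P? {xs = []} p) ⟩
      m ⊓ K + 1
    ≡⟨ cong (_+ 1) (m≤n⇒m⊓n≡m (<⇒≤ (to last⇔ p))) ⟩
      m + 1
    ≡⟨ +-comm m 1 ⟩
      suc m
    ≡⟨ sym (m≤n⇒m⊓n≡m (to last⇔ p)) ⟩
      suc m ⊓ K ∎
  lastStep (no ¬p) = begin
      m ⊓ K + length (filter P? (suc m ∷ []))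
    ≡⟨ cong (λ l → m ⊓ K + length l) (filter-reject P? {xs = []} ¬p) ⟩
      m ⊓ K + 0
    ≡⟨ +-identityʳ _ ⟩
      m ⊓ K
    ≡⟨ m≥n⇒m⊓n≡n K≤m ⟩
      K
    ≡⟨ sym (m≥n⇒m⊓n≡n (m≤n⇒m≤1+n K≤m)) ⟩
      suc m ⊓ K ∎
    where
    K≤m : K ≤ m
    K≤m = ≮⇒≥ (λ m<K → ¬p (from last⇔ m<K))

step-mono-≤ : (f : ℕ → ℕ) → (∀ y → f y ≤ f (suc y)) → ∀ {y z} → y ≤ z → f y ≤ f z
step-mono-≤ f step y≤z = go (≤⇒≤′ y≤z)
  where
  go : ∀ {y z} → y ≤′ z → f y ≤ f z
  go ≤′-refl = ≤-refl
  go (≤′-step p) = ≤-trans (go p) (step _)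

strictMono-threshold : (f : ℕ → ℕ) → (∀ y → f y < f (suc y)) →
  ∀ {K r} → f K ≤ r → r < f (suc K) → ∀ y → f y ≤ r ⇔ y ≤ K
strictMono-threshold f step {K} fK≤r r<fK+1 y =
  mk⇔ (λ fy≤r → ≮⇒≥ (λ K<y → <⇒≱ (<-≤-trans r<fK+1 (mono K<y)) fy≤r))
      (λ y≤K → ≤-trans (mono y≤K) fK≤r)
  where
  mono : ∀ {y z} → y ≤ z → f y ≤ f z
  mono = step-mono-≤ f (λ y → <⇒≤ (step y))

-- No row above a longest row x is long enough to stop the prime path, so it runs
-- up to row 0 (λ₀ = +∞) and the strip has height x.
topStrip-covers : (Y Y' : YD) (x : ℕ) → 1 ≤ x → 1 ≤ Y x → Y (suc x) < Y x →
  (∀ z → 1 ≤ z → Y z ≤ Y x) →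
  (∀ z → 1 ≤ z → z ≤ x → Y' z ≡ Y z ∸ 1) →
  (∀ z → x < z → Y' z ≡ Y z) →
  Covers Y' Y
topStrip-covers Y Y' x 1≤x 1≤Yx corner longest inStrip outStrip =
  x , x , 1≤x , 1≤Yx , corner , (1≤x , ≤-refl , inj₁ refl , lower) , strip
  where
  lower : ∀ h → 1 ≤ h → h < x → ¬ HCond Y x h
  lower h _ h<x (inj₁ h≡x) = <-irrefl h≡x h<x
  lower h 1≤h _ (inj₂ (h<x , Yx+h≤)) =
    <-irrefl refl (<-≤-trans (m<m+n (Y x) 1≤h) (≤-trans Yx+h≤ (longest (x ∸ h) (m<n⇒0<n∸m h<x))))
  strip : ∀ z → 1 ≤ z → (InStrip x x z → Y' z ≡ Y z ∸ 1) × (¬ InStrip x x z → Y' z ≡ Y z)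
  strip z 1≤z = (λ { (_ , z≤x) → inStrip z 1≤z z≤x })
              , (λ ∉strip → outStrip z (≰⇒> (λ z≤x → ∉strip (x∸x<z , z≤x))))
    where
    x∸x<z : x ∸ x < z
    x∸x<z = subst (_< z) (sym (n∸n≡0 x)) 1≤z

singleBox-covers : (Y Y' : YD) (w : ℕ) → 1 ≤ w → 1 ≤ Y (suc w) →
  Y (suc (suc w)) < Y (suc w) → Y (suc w) < Y w →
  Y' (suc w) ≡ Y (suc w) ∸ 1 →
  (∀ z → 1 ≤ z → z ≢ suc w → Y' z ≡ Y z) →
  Covers Y' Y
singleBox-covers Y Y' w 1≤w 1≤Y corner step inBox outBox =
  suc w , 1 , s≤s z≤n , 1≤Y , corner , (s≤s z≤n , s≤s z≤n , inj₂ (s≤s 1≤w , Y+1≤) , lower) , strip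
  where
  Y+1≤ : Y (suc w) + 1 ≤ Y w
  Y+1≤ = subst (_≤ Y w) (+-comm 1 (Y (suc w))) step
  lower : ∀ h → 1 ≤ h → h < 1 → ¬ HCond Y (suc w) h
  lower h 1≤h h<1 _ = <-irrefl refl (<-≤-trans h<1 1≤h)
  strip : ∀ z → 1 ≤ z → (InStrip (suc w) 1 z → Y' z ≡ Y z ∸ 1) × (¬ InStrip (suc w) 1 z → Y' z ≡ Y z)
  strip z 1≤z = (λ { (w<z , z≤sw) → subst (λ v → Y' v ≡ Y v ∸ 1) (≤-antisym w<z z≤sw) inBox })
              , (λ ∉strip → outBox z 1≤z (λ { refl → ∉strip (≤-refl , ≤-refl) }))

double : ℕ → ℕ
double zero = zero
double (suc a) = 2 + double a

triple : ℕ → ℕ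
triple zero = zero
triple (suc a) = 3 + triple a

innerLabel : ℕ → ℕ
innerLabel 0 = 0
innerLabel 1 = 1
innerLabel 2 = 2
innerLabel (suc (suc (suc y))) = 3 + innerLabel (suc y)

lastLabel : ℕ → ℕ
lastLabel 0 = 0
lastLabel 1 = 3
lastLabel 2 = 2
lastLabel (suc (suc (suc y))) = 3 + lastLabel (suc y)

innerLabel-odd : ∀ a → innerLabel (suc (double a)) ≡ suc (triple a)
innerLabel-odd zero = refl
innerLabel-odd (suc a) = cong (3 +_) (innerLabel-odd a)

innerLabel-even : ∀ a → innerLabel (2 + double a) ≡ 2 + triple a
innerLabel-even zero = refl
innerLabel-even (suc a) = cong (3 +_) (innerLabel-even a)

lastLabel-odd : ∀ a → lastLabel (suc (double a)) ≡ 3 + triple a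
lastLabel-odd zero = refl
lastLabel-odd (suc a) = cong (3 +_) (lastLabel-odd a)

lastLabel-even : ∀ a → lastLabel (2 + double a) ≡ 2 + triple a
lastLabel-even zero = refl
lastLabel-even (suc a) = cong (3 +_) (lastLabel-even a)

lastLabel-double : ∀ a → lastLabel (double a) ≡ innerLabel (double a)
lastLabel-double zero = refl
lastLabel-double (suc a) = trans (lastLabel-even a) (sym (innerLabel-even a))

innerLabel-double : ∀ a → innerLabel (double a) ≤ triple a
innerLabel-double zero = z≤n
innerLabel-double (suc a) = m≤n⇒m≤1+n (≤-reflexive (innerLabel-even a))

innerLabel-< : ∀ y → innerLabel y < innerLabel (suc y)
innerLabel-< 0 = s≤s z≤n
innerLabel-< 1 = s≤s (s≤s z≤n)
innerLabel-< 2 = s≤s (s≤s (s≤s z≤n))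
innerLabel-< (suc (suc (suc y))) = +-monoʳ-< 3 (innerLabel-< (suc y))

innerLabel-pos : ∀ y → 1 ≤ innerLabel (suc y)
innerLabel-pos y = ≤-trans (s≤s z≤n) (innerLabel-< y)

innerLabel≤lastLabel : ∀ y → innerLabel y ≤ lastLabel y
innerLabel≤lastLabel 0 = z≤n
innerLabel≤lastLabel 1 = s≤s z≤n
innerLabel≤lastLabel 2 = ≤-refl
innerLabel≤lastLabel (suc (suc (suc y))) = +-monoʳ-≤ 3 (innerLabel≤lastLabel (suc y))

innerLabel≢3+triple : ∀ y a → innerLabel y ≢ 3 + triple a
innerLabel≢3+triple 0 a ()
innerLabel≢3+triple 1 a ()
innerLabel≢3+triple 2 a ()
innerLabel≢3+triple (suc (suc (suc y))) zero eq = <⇒≢ (innerLabel-pos y) (sym (+-cancelˡ-≡ 3 _ _ eq))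
innerLabel≢3+triple (suc (suc (suc y))) (suc a) eq = innerLabel≢3+triple (suc y) a (+-cancelˡ-≡ 3 _ _ eq)

lastLabel-≤ : ∀ a y → y ≤ double a → lastLabel y ≤ triple a
lastLabel-≤ a 0 _ = z≤n
lastLabel-≤ (suc a) 1 _ = s≤s (s≤s (s≤s z≤n))
lastLabel-≤ (suc a) 2 _ = s≤s (s≤s z≤n)
lastLabel-≤ (suc a) (suc (suc (suc y))) (s≤s (s≤s y≤)) = +-monoʳ-≤ 3 (lastLabel-≤ a (suc y) y≤)

lastLabel-≥ : ∀ a y → suc (double a) ≤ y → 2 + triple a ≤ lastLabel y
lastLabel-≥ zero 1 _ = s≤s (s≤s z≤n)
lastLabel-≥ zero 2 _ = ≤-refl
lastLabel-≥ zero (suc (suc (suc y))) _ = s≤s (s≤s z≤n)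
lastLabel-≥ (suc a) (suc (suc (suc y))) (s≤s (s≤s y≥)) = +-monoʳ-≤ 3 (lastLabel-≥ a (suc y) y≥)

innerLabel-threshold : ∀ {K r} → innerLabel K ≤ r → r < innerLabel (suc K) →
  ∀ y → innerLabel y ≤ r ⇔ y ≤ K
innerLabel-threshold = strictMono-threshold innerLabel innerLabel-<

innerLabel≤triple⇔ : ∀ a y → innerLabel y ≤ triple a ⇔ y ≤ double a
innerLabel≤triple⇔ a = innerLabel-threshold (innerLabel-double a) (≤-reflexive (sym (innerLabel-odd a)))

innerLabel≤1+triple⇔ : ∀ a y → innerLabel y ≤ 1 + triple a ⇔ y ≤ 1 + double a
innerLabel≤1+triple⇔ a =
  innerLabel-threshold (≤-reflexive (innerLabel-odd a)) (≤-reflexive (sym (innerLabel-even a)))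

innerLabel≤2+triple⇔ : ∀ a y → innerLabel y ≤ 2 + triple a ⇔ y ≤ 2 + double a
innerLabel≤2+triple⇔ a = innerLabel-threshold (≤-reflexive (innerLabel-even a))
  (≤-trans (n≤1+n _) (≤-reflexive (sym (innerLabel-odd (suc a)))))

lastLabel≤triple⇔ : ∀ a y → lastLabel y ≤ triple a ⇔ y ≤ double a
lastLabel≤triple⇔ a y = mk⇔
  (λ ≤triple → ≮⇒≥ (λ y> → <⇒≱ (lastLabel-≥ a y y>) (m≤n⇒m≤1+n ≤triple)))
  (lastLabel-≤ a y)

lastLabel≤1+triple⇔ : ∀ a y → y ≢ suc (double a) → lastLabel y ≤ 1 + triple a ⇔ y ≤ 1 + double a
lastLabel≤1+triple⇔ a y y≢ = mk⇔
  (λ ≤triple → ≮⇒≥ (λ y> → <⇒≱ (lastLabel-≥ a y (<⇒≤ y>)) ≤triple))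
  (λ y≤ → m≤n⇒m≤1+n (lastLabel-≤ a y (≤-pred (≤∧≢⇒< y≤ y≢))))

lastLabel≤2+triple⇔ : ∀ a y → y ≢ suc (double a) → lastLabel y ≤ 2 + triple a ⇔ y ≤ 2 + double a
lastLabel≤2+triple⇔ a y y≢ = mk⇔
  (λ ≤triple → ≮⇒≥ (λ y> → <⇒≱ (lastLabel-≥ (suc a) y y>) (m≤n⇒m≤o+n 2 ≤triple)))
  from₂
  where
  from₂ : y ≤ 2 + double a → lastLabel y ≤ 2 + triple a
  from₂ y≤ with y ≟ 2 + double a
  ... | yes refl = ≤-reflexive (lastLabel-even a)
  ... | no y≢′ = ≤-trans (lastLabel-≤ a y (≤-pred (≤∧≢⇒< (≤-pred (≤∧≢⇒< y≤ y≢′)) y≢)))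
                         (m≤n+m _ 2)

rowLabel : ℕ → ℕ → ℕ
rowLabel M y = if y ≡ᵇ M then lastLabel y else innerLabel y

rowLabel-last : ∀ M → rowLabel M M ≡ lastLabel M
rowLabel-last M with M ≡ᵇ M | ≡⇒≡ᵇ M M refl
... | true | _ = refl

rowLabel-inner : ∀ M y → y ≢ M → rowLabel M y ≡ innerLabel y
rowLabel-inner M y y≢M with y ≡ᵇ M | ≡ᵇ⇒≡ y M
... | false | _ = refl
... | true | y≡M = contradiction (y≡M _) y≢M

rowLabel≡innerLabel : ∀ M y → lastLabel y ≡ innerLabel y → rowLabel M y ≡ innerLabel y
rowLabel≡innerLabel M y last≡inner with y ≟ M
... | yes refl = trans (rowLabel-last y) last≡inner
... | no y≢M = rowLabel-inner M y y≢M

innerLabel≤rowLabel : ∀ M y → innerLabel y ≤ rowLabel M y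
innerLabel≤rowLabel M y with y ≟ M
... | yes refl = subst (innerLabel y ≤_) (sym (rowLabel-last y)) (innerLabel≤lastLabel y)
... | no y≢M = ≤-reflexive (sym (rowLabel-inner M y y≢M))

rowLabel≤lastLabel : ∀ M y → rowLabel M y ≤ lastLabel y
rowLabel≤lastLabel M y with y ≟ M
... | yes refl = ≤-reflexive (rowLabel-last y)
... | no y≢M = subst (_≤ lastLabel y) (sym (rowLabel-inner M y y≢M)) (innerLabel≤lastLabel y)

rowLabel≤⇔ : ∀ M r K y →
  (y ≢ M → innerLabel y ≤ r ⇔ y ≤ K) → (y ≡ M → lastLabel y ≤ r ⇔ y ≤ K) →
  rowLabel M y ≤ r ⇔ y ≤ K
rowLabel≤⇔ M r K y inner last with y ≟ M
... | yes refl = subst (λ l → l ≤ r ⇔ y ≤ K) (sym (rowLabel-last y)) (last refl)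
... | no y≢M = subst (λ l → l ≤ r ⇔ y ≤ K) (sym (rowLabel-inner M y y≢M)) (inner y≢M)

-- shapeLe n (staircaseFilling n) r x unfolds to rowCount (n ∸ x) r.
rowCount : ℕ → ℕ → ℕ
rowCount M r = length (filter (λ y → rowLabel M y ≤? r) (map suc (upTo M)))

rowCount-threshold : ∀ M r K → (∀ y → 1 ≤ y → y ≤ M → rowLabel M y ≤ r ⇔ y ≤ K) →
  rowCount M r ≡ M ⊓ K
rowCount-threshold M r K = length-filter-threshold (λ y → rowLabel M y ≤? r) K M

rowCount-triple : ∀ M a → rowCount M (triple a) ≡ M ⊓ double a
rowCount-triple M a = rowCount-threshold M _ _ λ y _ _ →
  rowLabel≤⇔ M _ _ y (λ _ → innerLabel≤triple⇔ a y) (λ _ → lastLabel≤triple⇔ a y)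

rowCount-1+triple : ∀ M a → M ≢ suc (double a) → rowCount M (1 + triple a) ≡ M ⊓ (1 + double a)
rowCount-1+triple M a M≢ = rowCount-threshold M _ _ λ y _ _ →
  rowLabel≤⇔ M _ _ y (λ _ → innerLabel≤1+triple⇔ a y)
    (λ { refl → lastLabel≤1+triple⇔ a y M≢ })

rowCount-2+triple : ∀ M a → M ≢ suc (double a) → rowCount M (2 + triple a) ≡ M ⊓ (2 + double a)
rowCount-2+triple M a M≢ = rowCount-threshold M _ _ λ y _ _ →
  rowLabel≤⇔ M _ _ y (λ _ → innerLabel≤2+triple⇔ a y)
    (λ { refl → lastLabel≤2+triple⇔ a y M≢ })

rowCount-oddRow : ∀ a r → triple a ≤ r → r < 3 + triple a → rowCount (suc (double a)) r ≡ double a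
rowCount-oddRow a r triple≤r r< =
  trans (rowCount-threshold _ r (double a) λ y _ y≤ → rowLabel≤⇔ _ r _ y (inner y y≤) (last y))
        (m≥n⇒m⊓n≡n (n≤1+n _))
  where
  inner : ∀ y → y ≤ suc (double a) → y ≢ suc (double a) → innerLabel y ≤ r ⇔ y ≤ double a
  inner y y≤ y≢ = mk⇔ (λ _ → ≤-pred (≤∧≢⇒< y≤ y≢))
                      (λ y≤2a → ≤-trans (from (innerLabel≤triple⇔ a y) y≤2a) triple≤r)
  last : ∀ y → y ≡ suc (double a) → lastLabel y ≤ r ⇔ y ≤ double a
  last y refl = mk⇔ (λ l≤r → contradiction (≤-trans (≤-reflexive (sym (lastLabel-odd a))) l≤r) (<⇒≱ r<))
                    (λ y≤2a → contradiction y≤2a (1+n≰n))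

staircaseFilling : ℕ → Filling
staircaseFilling n x y = rowLabel (n ∸ x) y

data BlockLabel (a : ℕ) : ℕ → Set where
  first  : BlockLabel a (1 + triple a)
  second : BlockLabel a (2 + triple a)
  third  : BlockLabel a (3 + triple a)

-- Rows 1 … 2b+1 are longer than 2a+1, row 2b+2 has length exactly 2a+1 and the
-- rows below are shorter; the three labels of block a only change columns 2a+1, 2a+2.
module Block (a b n : ℕ) (n≡ : n ≡ (2 + double b) + suc (double a)) where

  lastLongRow oddRow : ℕ
  lastLongRow = suc (double b)
  oddRow = suc lastLongRow

  shape : ℕ → YD
  shape = shapeLe n (staircaseFilling n)

  shape-rowCount : ∀ r z {M} → n ∸ z ≡ M → shape r z ≡ rowCount M r
  shape-rowCount r z = cong (λ M → rowCount M r)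

  oddRow-length : n ∸ oddRow ≡ suc (double a)
  oddRow-length = trans (cong (_∸ oddRow) n≡) (m+n∸m≡n oddRow (suc (double a)))

  lastLongRow-length : n ∸ lastLongRow ≡ 2 + double a
  lastLongRow-length = trans (cong (_∸ lastLongRow) (trans n≡ (sym (+-suc lastLongRow (suc (double a))))))
                             (m+n∸m≡n lastLongRow (2 + double a))

  belowOddRow-length : n ∸ suc oddRow ≡ double a
  belowOddRow-length = trans (sym (pred[m∸n]≡m∸[1+n] n oddRow)) (cong pred oddRow-length)

  long-rows : ∀ z → z ≤ lastLongRow → 2 + double a ≤ n ∸ z
  long-rows z z≤ = subst (_≤ n ∸ z) lastLongRow-length (∸-monoʳ-≤ n z≤)

  short-rows : ∀ z → oddRow < z → n ∸ z ≤ double a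
  short-rows z z> = subst (n ∸ z ≤_) belowOddRow-length (∸-monoʳ-≤ n z>)

  long-row-not-odd : ∀ z → z ≤ lastLongRow → n ∸ z ≢ suc (double a)
  long-row-not-odd z z≤ eq = 1+n≰n (subst (2 + double a ≤_) eq (long-rows z z≤))

  odd-length-row : ∀ z → n ∸ z ≡ suc (double a) → z ≡ oddRow
  odd-length-row z eq with <-cmp z oddRow
  ... | tri< z< _ _ = contradiction eq (long-row-not-odd z (≤-pred z<))
  ... | tri≈ _ z≡ _ = z≡
  ... | tri> _ _ z> = contradiction (subst (_≤ double a) eq (short-rows z z>)) 1+n≰n

  columnCover : ∀ r r' K → double a ≤ K → K ≤ suc (double a) →
    (∀ M → M ≢ suc (double a) → rowCount M r ≡ M ⊓ suc K) → rowCount (suc (double a)) r ≡ double a →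
    (∀ M → M ≢ suc (double a) → rowCount M r' ≡ M ⊓ K) → rowCount (suc (double a)) r' ≡ double a →
    Covers (shape r') (shape r)
  columnCover r r' K 2a≤K K≤ count countOdd count' countOdd' =
    topStrip-covers (shape r) (shape r') lastLongRow (s≤s z≤n)
      (subst (1 ≤_) (sym atLastLong) (s≤s z≤n))
      (subst₂ _<_ (sym atOdd) (sym atLastLong) (s≤s 2a≤K))
      longest inStrip outStrip
    where
    atLastLong : shape r lastLongRow ≡ suc K
    atLastLong = trans (shape-rowCount r lastLongRow lastLongRow-length)
                       (trans (count (2 + double a) (λ eq → 1+n≰n (≤-reflexive eq)))
                              (m≥n⇒m⊓n≡n (s≤s K≤)))
    atOdd : shape r oddRow ≡ double a
    atOdd = trans (shape-rowCount r oddRow oddRow-length) countOdd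
    longest : ∀ z → 1 ≤ z → shape r z ≤ shape r lastLongRow
    longest z _ rewrite atLastLong with n ∸ z ≟ suc (double a)
    ... | yes eq = subst (_≤ suc K) (sym (trans (shape-rowCount r z eq) countOdd)) (m≤n⇒m≤1+n 2a≤K)
    ... | no neq = subst (_≤ suc K) (sym (count (n ∸ z) neq)) (m⊓n≤n _ _)
    inStrip : ∀ z → 1 ≤ z → z ≤ lastLongRow → shape r' z ≡ shape r z ∸ 1
    inStrip z _ z≤ = begin
        shape r' z      ≡⟨ count' (n ∸ z) neq ⟩
        (n ∸ z) ⊓ K     ≡⟨ m≥n⇒m⊓n≡n (≤-trans K≤ (<⇒≤ long)) ⟩
        K               ≡⟨ cong (_∸ 1) (sym (m≥n⇒m⊓n≡n (≤-trans (s≤s K≤) long))) ⟩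
        (n ∸ z) ⊓ suc K ∸ 1 ≡⟨ cong (_∸ 1) (sym (count (n ∸ z) neq)) ⟩
        shape r z ∸ 1   ∎
      where
      open ≡-Reasoning
      long = long-rows z z≤
      neq = long-row-not-odd z z≤
    outStrip : ∀ z → lastLongRow < z → shape r' z ≡ shape r z
    outStrip z z> with z ≟ oddRow
    ... | yes refl = trans (shape-rowCount r' oddRow oddRow-length) (trans countOdd' (sym atOdd))
    ... | no z≢ = trans (count' (n ∸ z) neq) (trans (m≤n⇒m⊓n≡m (≤-trans short 2a≤K))
                    (sym (trans (count (n ∸ z) neq) (m≤n⇒m⊓n≡m (≤-trans short (m≤n⇒m≤1+n 2a≤K))))))
      where
      short = short-rows z (≤∧≢⇒< z> (z≢ ∘ sym))
      neq = λ eq → z≢ (odd-length-row z eq)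

  cover : ∀ {r} → BlockLabel a r → Covers (shape (r ∸ 1)) (shape r)
  cover first = columnCover _ _ (double a) ≤-refl (n≤1+n _)
    (λ M → rowCount-1+triple M a) (rowCount-oddRow a _ (n≤1+n _) (s≤s (n≤1+n _)))
    (λ M _ → rowCount-triple M a) (trans (rowCount-triple _ a) (m≥n⇒m⊓n≡n (n≤1+n _)))
  cover second = columnCover _ _ (suc (double a)) (n≤1+n _) ≤-refl
    (λ M → rowCount-2+triple M a) (rowCount-oddRow a _ (m≤n+m _ 2) ≤-refl)
    (λ M → rowCount-1+triple M a) (rowCount-oddRow a _ (n≤1+n _) (s≤s (n≤1+n _)))
  cover third = singleBox-covers (shape (3 + triple a)) (shape (2 + triple a)) lastLongRow (s≤s z≤n)
    (subst (1 ≤_) (sym atOdd) (s≤s z≤n))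
    (subst₂ _<_ (sym atBelow) (sym atOdd) ≤-refl)
    (subst₂ _<_ (sym atOdd) (sym atLastLong) ≤-refl)
    (trans (shape-rowCount _ oddRow oddRow-length) (trans (rowCount-oddRow a _ (m≤n+m _ 2) ≤-refl)
                                                          (cong (_∸ 1) (sym atOdd))))
    elsewhere
    where
    atOdd : shape (3 + triple a) oddRow ≡ suc (double a)
    atOdd = trans (shape-rowCount _ oddRow oddRow-length)
                  (trans (rowCount-triple _ (suc a)) (m≤n⇒m⊓n≡m (n≤1+n _)))
    atBelow : shape (3 + triple a) (suc oddRow) ≡ double a
    atBelow = trans (shape-rowCount _ (suc oddRow) belowOddRow-length)
                    (trans (rowCount-triple _ (suc a)) (m≤n⇒m⊓n≡m (≤-trans (n≤1+n _) (n≤1+n _))))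
    atLastLong : shape (3 + triple a) lastLongRow ≡ 2 + double a
    atLastLong = trans (shape-rowCount _ lastLongRow lastLongRow-length)
                       (trans (rowCount-triple _ (suc a)) (⊓-idem _))
    elsewhere : ∀ z → 1 ≤ z → z ≢ oddRow → shape (2 + triple a) z ≡ shape (3 + triple a) z
    elsewhere z _ z≢ = trans (rowCount-2+triple (n ∸ z) a (z≢ ∘ odd-length-row z))
                             (sym (rowCount-triple (n ∸ z) (suc a)))

  labelled-box : ∀ {r} → BlockLabel a r →
    Σ ℕ λ x → Σ ℕ λ y → InShape n x y × (staircaseFilling n x y ≡ r)
  labelled-box first = 1 , suc (double a) , (s≤s z≤n , s≤s z≤n , fits) ,
      trans (rowLabel-inner (n ∸ 1) (suc (double a)) (long-row-not-odd 1 (s≤s z≤n) ∘ sym)) (innerLabel-odd a)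
    where
    fits : 2 + double a ≤ n
    fits = subst (2 + double a ≤_) (sym n≡) (s≤s (m≤n+m (suc (double a)) lastLongRow))
  labelled-box second = 1 , 2 + double a , (s≤s z≤n , s≤s z≤n , fits) ,
      trans (rowLabel≡innerLabel (n ∸ 1) (2 + double a) (trans (lastLabel-even a) (sym (innerLabel-even a))))
            (innerLabel-even a)
    where
    fits : 3 + double a ≤ n
    fits = subst (3 + double a ≤_) (sym n≡) (s≤s (s≤s (m≤n+m (suc (double a)) (double b))))
  labelled-box third = oddRow , suc (double a) , (s≤s z≤n , s≤s z≤n , ≤-reflexive (sym n≡)) ,
      trans (cong (λ M → rowLabel M (suc (double a))) oddRow-length)
            (trans (rowLabel-last (suc (double a))) (lastLabel-odd a))

topBlockLabel : ∀ a r → suc (triple a) ≤ r → r ≤ 3 + triple a → BlockLabel a r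
topBlockLabel a r lo hi with r ≟ 1 + triple a | r ≟ 2 + triple a
... | yes refl | _ = first
... | no _ | yes refl = second
... | no r≢1 | no r≢2 =
  subst (BlockLabel a) (≤-antisym (≤∧≢⇒< (≤∧≢⇒< lo (r≢1 ∘ sym)) (r≢2 ∘ sym)) hi) third

blockLabel : ∀ j r → 1 ≤ r → r ≤ triple j →
  Σ ℕ λ a → Σ ℕ λ b → (j ≡ suc (a + b)) × BlockLabel a r
blockLabel zero r 1≤r r≤0 = contradiction (≤-trans 1≤r r≤0) λ ()
blockLabel (suc j) r 1≤r r≤ with suc (triple j) ≤? r
... | yes lo = j , 0 , cong suc (sym (+-identityʳ j)) , topBlockLabel j r lo r≤
... | no ¬lo with blockLabel j r 1≤r (≤-pred (≰⇒> ¬lo))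
...   | a , b , j≡ , lab = a , suc b , cong suc (trans j≡ (sym (+-suc a b))) , lab

double-+ : ∀ a b → double (a + b) ≡ double a + double b
double-+ zero b = refl
double-+ (suc a) b = cong (2 +_) (double-+ a b)

staircase-split : ∀ a b → suc (double (suc (a + b))) ≡ (2 + double b) + suc (double a)
staircase-split a b = cong (2 +_) (trans (cong suc (trans (double-+ a b) (+-comm (double a) (double b))))
                                         (sym (+-suc (double b) (double a))))

data DoubleView : ℕ → Set where
  even : ∀ p → DoubleView (double p)
  odd  : ∀ p → DoubleView (suc (double p))

doubleView : ∀ m → DoubleView m
doubleView zero = even 0
doubleView (suc m) with doubleView m
... | even p = odd p
... | odd p = even (suc p)

innerLabel≡lastLabel⇒even : ∀ y m → 1 ≤ m → innerLabel y ≡ lastLabel m →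
  Σ ℕ λ q → m ≡ 2 + double q
innerLabel≡lastLabel⇒even y m 1≤m eq with doubleView m
... | even zero = contradiction 1≤m λ ()
... | even (suc q) = q , refl
... | odd p = contradiction (trans eq (lastLabel-odd p)) (innerLabel≢3+triple y p)

rowLabel-double : ∀ j y → rowLabel (double j) y ≡ innerLabel y
rowLabel-double j y with y ≟ double j
... | yes refl = rowLabel≡innerLabel (double j) y (lastLabel-double j)
... | no y≢ = rowLabel-inner (double j) y y≢

no-plusFullSet : ∀ j r → ¬ PlusFullSet (suc (double j)) (staircaseFilling (suc (double j))) r
no-plusFullSet j r (k , ((y , _ , row1≡r) , _ , k≤ , (_ , rowk≡r , _)) , plus) =
  excluded (innerLabel≡lastLabel⇒even y (n ∸ k) (m<n⇒0<n∸m (s≤s k≤)) inner≡last) plus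
  where
  n = suc (double j)
  inner≡last : innerLabel y ≡ lastLabel (n ∸ k)
  inner≡last = trans (sym (rowLabel-double j y)) (trans row1≡r (trans (sym rowk≡r) (rowLabel-last (n ∸ k))))
  excluded : (Σ ℕ λ q → n ∸ k ≡ 2 + double q) →
    (k ≡ n ∸ 1) ⊎ ((k ≤ n ∸ 2) × (staircaseFilling n (suc k) (n ∸ k ∸ 1) < r)) → ⊥
  excluded (q , m≡) (inj₁ refl) = contradiction (trans (sym (m+n∸n≡m 1 (double j))) m≡) λ ()
  excluded (q , m≡) (inj₂ (_ , below<r)) = <⇒≱ below<r (begin
      r                                          ≡⟨ trans (sym rowk≡r) (rowLabel-last (n ∸ k)) ⟩
      lastLabel (n ∸ k)                          ≡⟨ trans (cong lastLabel m≡) (lastLabel-even q) ⟩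
      2 + triple q                               <⟨ ≤-refl ⟩
      3 + triple q                               ≡⟨ sym (lastLabel-odd q) ⟩
      lastLabel (suc (double q))                 ≡⟨ sym (rowLabel-last (suc (double q))) ⟩
      rowLabel (suc (double q)) (suc (double q)) ≡⟨ cong₂ rowLabel (sym rowBelow-length) (sym (cong (_∸ 1) m≡)) ⟩
      staircaseFilling n (suc k) (n ∸ k ∸ 1)     ∎)
    where
    open ≤-Reasoning
    rowBelow-length : n ∸ suc k ≡ suc (double q)
    rowBelow-length = trans (sym (pred[m∸n]≡m∸[1+n] n k)) (cong pred m≡)

staircaseFilling-inner : ∀ n x y → x + suc y ≤ n → staircaseFilling n x y ≡ innerLabel y
staircaseFilling-inner n x y fits = rowLabel-inner (n ∸ x) y λ { refl → 1+n≰n y< }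
  where
  y< : suc y ≤ n ∸ x
  y< = m+n≤o⇒m≤o∸n (suc y) (subst (_≤ n) (+-comm x (suc y)) fits)

staircaseFilling-rows : ∀ n x y → InShape n x (suc y) →
  staircaseFilling n x y < staircaseFilling n x (suc y)
staircaseFilling-rows n x y (_ , _ , fits) =
  subst (_< staircaseFilling n x (suc y)) (sym (staircaseFilling-inner n x y fits))
        (<-≤-trans (innerLabel-< y) (innerLabel≤rowLabel (n ∸ x) (suc y)))

staircaseFilling-columns : ∀ n x y → InShape n (suc x) y →
  staircaseFilling n x y ≤ staircaseFilling n (suc x) y
staircaseFilling-columns n x y (_ , _ , fits) =
  subst (_≤ staircaseFilling n (suc x) y)
        (sym (staircaseFilling-inner n x y (subst (_≤ n) (sym (+-suc x y)) fits)))
        (innerLabel≤rowLabel (n ∸ suc x) y)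

staircaseFilling-bounds : ∀ j x y → InShape (suc (double j)) x y →
  (1 ≤ staircaseFilling (suc (double j)) x y) × (staircaseFilling (suc (double j)) x y ≤ triple j)
staircaseFilling-bounds j x (suc y) (1≤x , _ , fits) =
  ≤-trans (innerLabel-pos y) (innerLabel≤rowLabel (suc (double j) ∸ x) (suc y)) ,
  ≤-trans (rowLabel≤lastLabel (suc (double j) ∸ x) (suc y))
          (lastLabel-≤ j (suc y) (≤-pred (≤-trans (+-monoˡ-≤ (suc y) 1≤x) fits)))

staircaseFilling-InN : ∀ j → InN (suc (double j)) (triple j) (staircaseFilling (suc (double j)))
staircaseFilling-InN j =
  ((staircaseFilling-bounds j , labelled , (λ x y _ → staircaseFilling-rows n x y) ,
     (λ x y _ → staircaseFilling-columns n x y)) , covers) ,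
  λ r _ _ → no-plusFullSet j r
  where
  n = suc (double j)
  n-split : ∀ a b → j ≡ suc (a + b) → n ≡ (2 + double b) + suc (double a)
  n-split a b j≡ = trans (cong (suc ∘ double) j≡) (staircase-split a b)
  labelled : ∀ r → 1 ≤ r → r ≤ triple j →
    Σ ℕ λ x → Σ ℕ λ y → InShape n x y × (staircaseFilling n x y ≡ r)
  labelled r 1≤r r≤ with blockLabel j r 1≤r r≤
  ... | a , b , j≡ , lab = Block.labelled-box a b n (n-split a b j≡) lab
  covers : ∀ r → 1 ≤ r → r ≤ triple j →
    Covers (shapeLe n (staircaseFilling n) (r ∸ 1)) (shapeLe n (staircaseFilling n) r)
  covers r 1≤r r≤ with blockLabel j r 1≤r r≤
  ... | a , b , j≡ , lab = Block.cover a b n (n-split a b j≡) lab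

2*≡double : ∀ j → 2 * j ≡ double j
2*≡double zero = refl
2*≡double (suc j) = trans (*-suc 2 j) (cong (2 +_) (2*≡double j))

3*≡triple : ∀ j → 3 * j ≡ triple j
3*≡triple zero = refl
3*≡triple (suc j) = trans (*-suc 3 j) (cong (3 +_) (3*≡triple j))

lemma5p7 : (j : ℕ) → Σ Filling (λ T → InN (suc (2 * j)) (3 * j) T)
lemma5p7 j = staircaseFilling (suc (2 * j)) ,
  subst₂ (λ m l → InN (suc m) l (staircaseFilling (suc m))) (sym (2*≡double j)) (sym (3*≡triple j))
         (staircaseFilling-InN j)
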